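{- Let $\mathcal K$ be a projective Fraïssé class with projective Fraïssé limit $\mathbb K$ and let $n\in\mathbb N$. Given $B_i\in\mathcal K$ and $\varphi_i,\psi_i\in{\rm Epi}(\mathbb K,B_i)$ for $i<n$, there exist $A,B\in\mathcal K$, $f_i,g_i\in{\rm Epi}(A,B)$ for $i<n$, and $\varphi\in{\rm Epi}(\mathbb K,A)$ such that for all $i<n$: $B^{(1)}_{f_i,g_i;\varphi}\subseteq B^{(1)}_{\varphi_i,\psi_i}$ and $B^{(0)}_{f_i,g_i;\varphi}\subseteq B^{(0)}_{\varphi_i,\psi_i}$.
   Context: Reflexive graph: set with reflexive symmetric relation $R$; strong homomorphism: $R$-preserving map such that every $R$-related pair in the target is the image of an $R$-related pair. For maps $\alpha,\beta$ from a set $Z$ into a reflexive graph, $\alpha R\beta$ means $\alpha(z)R\beta(z)$ for all $z$. $\mathcal K$: countable category of finite reflexive graphs with morphism sets ${\rm Epi}(A,B)$ of strong homomorphisms, satisfying (o) [if $f\in{\rm Epi}(A,B)$, $h\in{\rm Epi}(A,C)$, $g:B\to C$, $h=g\circ f$, then $g\in{\rm Epi}(B,C)$], joint projection and projective amalgamation. $\mathbb K=\varprojlim(A_n,\pi_n)$ for a generic sequence ($A_n\in\mathcal K$, $\pi_n\in{\rm Epi}(A_{n+1},A_n)$, every $A\in\mathcal K$ receives a morphism from some $A_m$, every $f\in{\rm Epi}(A,A_m)$ satisfies $f\circ g=\pi_m\circ\cdots\circ\pi_{n-1}$ for some $n>m$, $g\in{\rm Epi}(A_n,A)$); ${\rm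 Epi}(\mathbb K,A)=\{f\circ\pi^\infty_n:f\in{\rm Epi}(A_n,A)\}$. ${\rm Aut}(\mathbb K)$: homeomorphisms $\sigma$ of $\mathbb K$ with $\varphi\circ\sigma,\varphi\circ\sigma^{ -1}\in{\rm Epi}(\mathbb K,A)$ whenever $\varphi\in{\rm Epi}(\mathbb K,A)$. For $\psi,\phi\in{\rm Epi}(\mathbb K,C)$: $B^{(0)}_{\psi,\phi}=\{\tau\in{\rm Aut}(\mathbb K):\psi=\phi\circ\tau\}$, $B^{(1)}_{\psi,\phi}=\{\tau\in{\rm Aut}(\mathbb K):\psi\,R\,\phi\circ\tau\}$. For $f,g\in{\rm Epi}(A,B)$ and $\varphi\in{\rm Epi}(\mathbb K,A)$: $B^{(k)}_{f,g;\varphi}=B^{(k)}_{f\circ\varphi,g\circ\varphi}$, $k=0,1$. -}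

module Defs where

open import Level using (0ℓ)
open import Data.Nat using (ℕ; zero; suc; _+_; _≤_)
open import Data.Fin using (Fin)
open import Data.Product using (Σ; ∃; _×_; _,_; proj₁; proj₂)
open import Relation.Binary.PropositionalEquality using (_≡_)
open import Function using (_∘_; id)

record RGraph : Set₁ where
  field
    size  : ℕ
    R     : Fin size → Fin size → Set
    R-refl : ∀ x → R x x
    R-sym  : ∀ {x y} → R x y → R y x

open RGraph public

V : RGraph → Set
V G = Fin (size G)

_≗_ : {X Y : Set} → (X → Y) → (X → Y) → Set
f ≗ g = ∀ x → f x ≡ g x

IsStrongHom : (G H : RGraph) → (V G → V H) → Set
IsStrongHom G H f =
  (∀ x y → R G x y → R H (f x) (f y)) ×
  (∀ u v → R H u v → Σ (V G) λ x → Σ (V G) λ y → R G x y × f x ≡ u × f y ≡ v)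

record ProjFraisseClass : Set₁ where
  field
    Obj    : Set
    graph  : Obj → RGraph
    enum      : ℕ → Obj
    enum-surj : ∀ (A : Obj) → Σ ℕ λ k → enum k ≡ A
    Epi    : (A B : Obj) → (V (graph A) → V (graph B)) → Set
    Epi-strong : ∀ {A B} {f} → Epi A B f → IsStrongHom (graph A) (graph B) f
    Epi-ext    : ∀ {A B} {f g} → f ≗ g → Epi A B f → Epi A B g
    Epi-id   : ∀ A → Epi A A id
    Epi-comp : ∀ {A B C} {f g} → Epi A B f → Epi B C g → Epi A C (g ∘ f)
    Epi-o : ∀ {A B C} {f h} (g : V (graph B) → V (graph C)) →
            Epi A B f → Epi A C h → h ≗ (g ∘ f) → Epi B C g
    jointProj : ∀ A B → Σ Obj λ C →
                (Σ (V (graph C) → V (graph A)) (Epi C A)) ×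
                (Σ (V (graph C) → V (graph B)) (Epi C B))
    amalg : ∀ {A B C} {f g} → Epi B A f → Epi C A g →
            Σ Obj λ D → Σ (V (graph D) → V (graph B)) λ f' →
            Σ (V (graph D) → V (graph C)) λ g' →
            Epi D B f' × Epi D C g' × (f ∘ f') ≗ (g ∘ g')

module _ (𝒦 : ProjFraisseClass) where
  open ProjFraisseClass 𝒦

  Vo : Obj → Set
  Vo A = V (graph A)

  record Sequence : Set where
    field
      A  : ℕ → Obj
      π  : (n : ℕ) → Vo (A (suc n)) → Vo (A n)
      π-epi : ∀ n → Epi (A (suc n)) (A n) (π n)

    -- πs m k = π_m ∘ π_{m+1} ∘ ⋯ ∘ π_{k+m-1} : A_{k+m} → A_m
    πs : (m k : ℕ) → Vo (A (k + m)) → Vo (A m)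
    πs m zero    = id
    πs m (suc k) = πs m k ∘ π (k + m)

  record IsGeneric (S : Sequence) : Set where
    open Sequence S
    field
      gen-proj : ∀ (B : Obj) → Σ ℕ λ m → Σ (Vo (A m) → Vo B) (Epi (A m) B)
      gen-abs  : ∀ (m : ℕ) (B : Obj) (f : Vo B → Vo (A m)) → Epi B (A m) f →
                 Σ ℕ λ k → Σ (Vo (A (suc k + m)) → Vo B) λ g →
                 Epi (A (suc k + m)) B g × (f ∘ g) ≗ πs m (suc k)

  module Limit (S : Sequence) where
    open Sequence S

    -- The inverse limit 𝕂 = lim (A_n, π_n): threads.
    record Pt : Set where
      constructor pt
      field
        coord : (n : ℕ) → Vo (A n)
        compat : ∀ n → π n (coord (suc n)) ≡ coord n
    open Pt public

    π∞ : (n : ℕ) → Pt → Vo (A n)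
    π∞ n x = coord x n

    EpiK : (B : Obj) → (Pt → Vo B) → Set
    EpiK B φ = Σ ℕ λ n → Σ (Vo (A n) → Vo B) λ f →
               Epi (A n) B f × φ ≗ (f ∘ π∞ n)

    _≈K_ : Pt → Pt → Set
    x ≈K y = ∀ n → coord x n ≡ coord y n

    -- Continuity of a map 𝕂 → 𝕂 (product topology of discrete finite
    -- sets; basic neighbourhoods of x are { y : y_n = x_n }).
    Continuous : (Pt → Pt) → Set
    Continuous σ = ∀ (x : Pt) (m : ℕ) → Σ ℕ λ n →
                   ∀ (y : Pt) → coord y n ≡ coord x n → coord (σ y) m ≡ coord (σ x) m

    record Aut : Set₁ where
      field
        σ    : Pt → Pt
        σ⁻¹  : Pt → Pt
        σ-cont   : Continuous σ
        σ⁻¹-cont : Continuous σ⁻¹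
        left-inv  : ∀ x → σ⁻¹ (σ x) ≈K x
        right-inv : ∀ x → σ (σ⁻¹ x) ≈K x
        pres     : ∀ (B : Obj) (φ : Pt → Vo B) → EpiK B φ → EpiK B (φ ∘ σ)
        pres⁻¹   : ∀ (B : Obj) (φ : Pt → Vo B) → EpiK B φ → EpiK B (φ ∘ σ⁻¹)

    B0 : {C : Obj} → (ψ φ : Pt → Vo C) → Aut → Set
    B0 ψ φ τ = ∀ x → ψ x ≡ φ (Aut.σ τ x)

    B1 : {C : Obj} → (ψ φ : Pt → Vo C) → Aut → Set
    B1 {C} ψ φ τ = ∀ x → R (graph C) (ψ x) (φ (Aut.σ τ x))

    B0' : {A' B : Obj} → (f g : Vo A' → Vo B) → (Pt → Vo A') → Aut → Set
    B0' f g φ = B0 (f ∘ φ) (g ∘ φ)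

    B1' : {A' B : Obj} → (f g : Vo A' → Vo B) → (Pt → Vo A') → Aut → Set
    B1' f g φ = B1 (f ∘ φ) (g ∘ φ)

{-# OPTIONS --safe #-}

-- Choose a level M at which every φᵢ factors as aᵢ ∘ π∞ M with aᵢ ∈ Epi(A_M, Bᵢ).
-- By the projective extension property of 𝕂 (amalgamate aᵢ with a factorisation
-- of ψᵢ, then absorb the amalgam into the generic sequence) each ψᵢ factors as
-- aᵢ ∘ Gᵢ with Gᵢ ∈ Epi(𝕂, A_M). Take B = A_M and A = A_J for a level J through
-- which π∞ M and every Gᵢ factor; fᵢ and gᵢ are those factors. Postcomposing with
-- the strong homomorphism aᵢ preserves both R and equality, which gives the two
-- inclusions.
module Submission where

open import Defs
open import Data.Nat using (ℕ; zero; suc; _+_; _∸_; _≤_; _⊔_)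
open import Data.Nat.Properties using (≤-refl; ≤-trans; m∸n+n≡m; m≤m⊔n; m≤n⊔m)
open import Data.Fin using (Fin)
open import Data.List using (tabulate)
open import Data.List.Extrema.Nat using (max; xs≤max)
open import Data.List.Relation.Unary.All.Properties using (tabulate⁻)
open import Data.Product using (Σ; _×_; _,_; proj₁; proj₂)
open import Relation.Binary.PropositionalEquality
  using (refl; sym; trans; cong; subst; subst₂; module ≡-Reasoning)
open import Function using (_∘_; id)

≗-refine : {X Y Z : Set} {φ : X → Z} {a : Y → Z} {F F′ : X → Y} →
           φ ≗ (a ∘ F) → F ≗ F′ → φ ≗ (a ∘ F′)
≗-refine {a = a} φ≗aF F≗F′ x = trans (φ≗aF x) (cong a (F≗F′ x))

module LimitProperties (𝒦 : ProjFraisseClass) (S : Sequence 𝒦) where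
  open ProjFraisseClass 𝒦
  open Sequence S
  open Limit 𝒦 S

  πs-epi : ∀ m k → Epi (A (k + m)) (A m) (πs m k)
  πs-epi m zero    = Epi-id (A m)
  πs-epi m (suc k) = Epi-comp (π-epi (k + m)) (πs-epi m k)

  π∞-πs : ∀ m k → π∞ m ≗ (πs m k ∘ π∞ (k + m))
  π∞-πs m zero    x = refl
  π∞-πs m (suc k) x = trans (π∞-πs m k x) (cong (πs m k) (sym (compat x (k + m))))

  record FactorsAt (B : Obj) (φ : Pt → Vo 𝒦 B) (N : ℕ) : Set where
    constructor factorsAt
    field
      map     : Vo 𝒦 (A N) → Vo 𝒦 B
      epi     : Epi (A N) B map
      factors : φ ≗ (map ∘ π∞ N)
  open FactorsAt public

  fromEpiK : ∀ {B φ} (φ-epi : EpiK B φ) → FactorsAt B φ (proj₁ φ-epi)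
  fromEpiK (N , f , f-epi , φ≗) = factorsAt f f-epi φ≗

  toEpiK : ∀ {B φ N} → FactorsAt B φ N → EpiK B φ
  toEpiK {N = N} (factorsAt f f-epi φ≗) = N , f , f-epi , φ≗

  π∞-factorsAt : ∀ N → FactorsAt (A N) (π∞ N) N
  π∞-factorsAt N = factorsAt id (Epi-id (A N)) (λ _ → refl)

  factorsAt-+ : ∀ {B φ m} → FactorsAt B φ m → ∀ k → FactorsAt B φ (k + m)
  factorsAt-+ {m = m} (factorsAt f f-epi φ≗) k =
    factorsAt (f ∘ πs m k) (Epi-comp (πs-epi m k) f-epi) (≗-refine {a = f} φ≗ (π∞-πs m k))

  factorsAt-≤ : ∀ {B φ m N} → FactorsAt B φ m → m ≤ N → FactorsAt B φ N
  factorsAt-≤ {B} {φ} {m} {N} r m≤N =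
    subst (FactorsAt B φ) (m∸n+n≡m m≤N) (factorsAt-+ r (N ∸ m))

  factorsAt-common : ∀ {n} {Bs : Fin n → Obj} {φs : ∀ i → Pt → Vo 𝒦 (Bs i)} →
                     (∀ i → EpiK (Bs i) (φs i)) →
                     Σ ℕ λ M → ∀ {N} → M ≤ N → ∀ i → FactorsAt (Bs i) (φs i) N
  factorsAt-common φs-epi =
    M , λ M≤N i → factorsAt-≤ (fromEpiK (φs-epi i)) (≤-trans (levels≤M i) M≤N)
    where
    M : ℕ
    M = max 0 (tabulate (proj₁ ∘ φs-epi))

    levels≤M : ∀ i → proj₁ (φs-epi i) ≤ M
    levels≤M = tabulate⁻ (xs≤max 0 (tabulate (proj₁ ∘ φs-epi)))

  Refines : ∀ {C D} (F G : Pt → Vo 𝒦 C) (φ ψ : Pt → Vo 𝒦 D) → Set₁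
  Refines F G φ ψ = (∀ τ → B1 F G τ → B1 φ ψ τ) × (∀ τ → B0 F G τ → B0 φ ψ τ)

  refines-postcomp : ∀ {C D} {F G : Pt → Vo 𝒦 C} {φ ψ : Pt → Vo 𝒦 D}
                     (a : Vo 𝒦 C → Vo 𝒦 D) →
                     (∀ x y → R (graph C) x y → R (graph D) (a x) (a y)) →
                     φ ≗ (a ∘ F) → ψ ≗ (a ∘ G) → Refines F G φ ψ
  refines-postcomp {D = D} a a-hom φ≗ ψ≗ =
    (λ τ FRG x → subst₂ (R (graph D)) (sym (φ≗ x)) (sym (ψ≗ (Aut.σ τ x))) (a-hom _ _ (FRG x))) ,
    (λ τ F≡G x → trans (φ≗ x) (trans (cong a (F≡G x)) (sym (ψ≗ (Aut.σ τ x)))))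

  projective-extension : IsGeneric 𝒦 S → ∀ {B C} {ψ : Pt → Vo 𝒦 B} {a : Vo 𝒦 C → Vo 𝒦 B} →
              EpiK B ψ → Epi C B a → Σ (Pt → Vo 𝒦 C) λ G → EpiK C G × ψ ≗ (a ∘ G)
  projective-extension gen {ψ = ψ} {a = a} (M , b , b-epi , ψ≗) a-epi with amalg b-epi a-epi
  ... | D , u , v , u-epi , v-epi , bu≗av with IsGeneric.gen-abs gen M D u u-epi
  ... | k , w , w-epi , uw≗πs =
    v ∘ w ∘ π∞ N , toEpiK (factorsAt (v ∘ w) (Epi-comp w-epi v-epi) (λ _ → refl)) , ψ≗avw
    where
    open ≡-Reasoning

    N : ℕ
    N = suc k + M

    ψ≗avw : ψ ≗ (a ∘ v ∘ w ∘ π∞ N)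
    ψ≗avw x = begin
      ψ x                          ≡⟨ ψ≗ x ⟩
      b (π∞ M x)                   ≡⟨ cong b (π∞-πs M (suc k) x) ⟩
      b (πs M (suc k) (π∞ N x))    ≡⟨ cong b (sym (uw≗πs (π∞ N x))) ⟩
      b (u (w (π∞ N x)))           ≡⟨ bu≗av (w (π∞ N x)) ⟩
      a (v (w (π∞ N x)))           ∎

lemma3p7 : (𝒦 : ProjFraisseClass) (S : Sequence 𝒦) → IsGeneric 𝒦 S →
    let open ProjFraisseClass 𝒦
        open Limit 𝒦 S
    in (n : ℕ) (Bs : Fin n → Obj)
       (φs ψs : (i : Fin n) → Pt → Vo 𝒦 (Bs i)) →
       (∀ i → EpiK (Bs i) (φs i)) → (∀ i → EpiK (Bs i) (ψs i)) →
       Σ Obj λ A → Σ Obj λ B →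
       Σ (Fin n → Vo 𝒦 A → Vo 𝒦 B) λ f → Σ (Fin n → Vo 𝒦 A → Vo 𝒦 B) λ g →
       (∀ i → Epi A B (f i)) × (∀ i → Epi A B (g i)) ×
       Σ (Pt → Vo 𝒦 A) λ φ → EpiK A φ ×
       (∀ i → (∀ (τ : Aut) → B1' (f i) (g i) φ τ → B1 (φs i) (ψs i) τ) ×
              (∀ (τ : Aut) → B0' (f i) (g i) φ τ → B0 (φs i) (ψs i) τ))
lemma3p7 𝒦 S gen n Bs φs ψs φs-epi ψs-epi =
  A J , A M , (λ _ → map f) , (λ i → map (g i)) , (λ _ → epi f) , (λ i → epi (g i)) ,
  π∞ J , toEpiK (π∞-factorsAt J) , refines
  where
  open ProjFraisseClass 𝒦
  open Sequence S
  open Limit 𝒦 S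
  open LimitProperties 𝒦 S

  M : ℕ
  M = proj₁ (factorsAt-common φs-epi)

  φ-at : ∀ i → FactorsAt (Bs i) (φs i) M
  φ-at = proj₂ (factorsAt-common φs-epi) ≤-refl

  lifts : ∀ i → Σ (Pt → Vo 𝒦 (A M)) λ G → EpiK (A M) G × ψs i ≗ (map (φ-at i) ∘ G)
  lifts i = projective-extension gen (ψs-epi i) (epi (φ-at i))

  lifts-common : Σ ℕ λ L → ∀ {N} → L ≤ N → ∀ i → FactorsAt (A M) (proj₁ (lifts i)) N
  lifts-common = factorsAt-common (proj₁ ∘ proj₂ ∘ lifts)

  J : ℕ
  J = proj₁ lifts-common ⊔ M

  f : FactorsAt (A M) (π∞ M) J
  f = factorsAt-≤ (π∞-factorsAt M) (m≤n⊔m (proj₁ lifts-common) M)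

  g : ∀ i → FactorsAt (A M) (proj₁ (lifts i)) J
  g = proj₂ lifts-common (m≤m⊔n (proj₁ lifts-common) M)

  refines : ∀ i → Refines (map f ∘ π∞ J) (map (g i) ∘ π∞ J) (φs i) (ψs i)
  refines i = refines-postcomp a (proj₁ (Epi-strong (epi (φ-at i))))
    (≗-refine {a = a} (factors (φ-at i)) (factors f))
    (≗-refine {a = a} (proj₂ (proj₂ (lifts i))) (factors (g i)))
    where a = map (φ-at i)
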